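{- Let $n\ge 1$ and let $CR_n$ be the crown graph with vertex set $A_n\cup A'_n$, $A_n=\{v_1,\dots,v_n\}$, $A'_n=\{v'_1,\dots,v'_n\}$, where $v_i$ is adjacent to $v'_j$ if and only if $i\ne j$, and there are no other edges. Let $<$ be a linear ordering of $V(CR_n)$ and $\mathcal{V}$ a partition of $V(CR_n)$. Then $<$ is consistent with $\mathcal{V}$ if and only if both of the following hold: (1) for every $V\in\mathcal{V}$ and every little vertex $v\in V$, $v$ is the smallest (according to $<$) element of $V\cap \mathrm{side}(v)$; (2) for every $V\in\mathcal{V}$ and all $1\le i,j\le n$ with $v_i,v'_j\in V$, there is no $z\ne i$ with $v_i<v'_j<v'_z$, and there is no $z\neq j$ with $v'_j<v_i<v_z$.
   Context: For a vertex $v_i$ let $\mathrm{mirror}(v_i)=v'_i$, $\mathrm{side}(v_i)=A_n$, and for $v'_i$ let $\mathrm{mirror}(v'_i)=v_i$, $\mathrm{side}(v'_i)=A'_n$. Given the ordering $<$, a vertex $v$ is little if $v<\mathrm{mirror}(v)$ and big otherwise. An ordering $<$ of $V(G)$ is consistent with a partition $\mathcal{V}$ of $V(G)$ if for every triple $p<q<r$ of vertices with $p,q$ in the same class of $\mathcal{V}$ and $pr\in E(G)$, also $qr\in E(G)$. -}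

module Defs where

open import Data.Nat using (ℕ)
open import Data.Fin using (Fin)
open import Data.Product using (_×_; _,_; ∃-syntax)
open import Data.Sum using (_⊎_)
open import Data.Empty using (⊥)
open import Relation.Binary.PropositionalEquality using (_≡_; _≢_)
open import Relation.Nullary using (¬_)

data Side : Set where
  A  : Side
  A' : Side

-- Vertices of CR_n: (A , i) is v_i, (A' , i) is v'_i  (indices i : Fin n).
Vertex : ℕ → Set
Vertex n = Side × Fin n

flip : Side → Side
flip A  = A'
flip A' = A

side : ∀ {n} → Vertex n → Side
side (s , i) = s

mirror : ∀ {n} → Vertex n → Vertex n
mirror (s , i) = (flip s , i)

Edge : ∀ {n} → Vertex n → Vertex n → Set
Edge (A  , i) (A' , j) = i ≢ j
Edge (A' , i) (A  , j) = i ≢ j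
Edge (A  , i) (A  , j) = ⊥
Edge (A' , i) (A' , j) = ⊥

module _ {n : ℕ} (_<_ : Vertex n → Vertex n → Set) where

  little : Vertex n → Set
  little v = v < mirror v

  -- A partition is given by a class-labelling function cls : Vertex n → ℕ;
  -- two vertices lie in the same class iff they have the same label.
  Consistent : (Vertex n → ℕ) → Set
  Consistent cls = ∀ p q r → p < q → q < r → cls p ≡ cls q → Edge p r → Edge q r

  Cond1 : (Vertex n → ℕ) → Set
  Cond1 cls = ∀ v → little v → ∀ w → cls w ≡ cls v → side w ≡ side v → (v ≡ w ⊎ v < w)

  Cond2 : (Vertex n → ℕ) → Set
  Cond2 cls = ∀ (i j : Fin n) → cls (A , i) ≡ cls (A' , j) →
      (¬ (∃[ z ] (z ≢ i × ((A , i) < (A' , j)) × ((A' , j) < (A' , z)))))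
    × (¬ (∃[ z ] (z ≢ j × ((A' , j) < (A , i)) × ((A , i) < (A , z)))))

{-# OPTIONS --safe #-}
module Submission where

-- In CR_n, for p and q on the same side and r on the other, pr ∈ E and qr ∉ E
-- happens exactly when r = mirror q; as q < r this makes q little, so consistency
-- on same-side pairs is condition (1). For p and q on opposite sides, pr ∈ E and
-- qr ∉ E means r lies on q's side with r ≠ q, which is what condition (2) forbids.

open import Defs
open import Data.Nat using (ℕ; _≤_)
open import Data.Product using (_×_; _,_; proj₁; proj₂)
open import Data.Sum using (inj₁; inj₂)
open import Data.Empty using (⊥-elim)
open import Function.Bundles using (_⇔_; mk⇔)
open import Relation.Binary.PropositionalEquality using (_≡_; _≢_; refl; sym; cong)
open import Relation.Binary.Structures using (IsStrictTotalOrder)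
open import Relation.Binary.Definitions using (tri<; tri≈; tri>)
open import Relation.Nullary using (¬_)

¬edge-mirror : ∀ {n} (v : Vertex n) → ¬ Edge v (mirror v)
¬edge-mirror (A  , i) i≢i = i≢i refl
¬edge-mirror (A' , i) i≢i = i≢i refl

edge-mirror : ∀ {n} {w v : Vertex n} → side w ≡ side v → w ≢ v → Edge w (mirror v)
edge-mirror {w = A  , i} {A  , k} refl w≢v i≡k = w≢v (cong (A  ,_) i≡k)
edge-mirror {w = A' , i} {A' , k} refl w≢v i≡k = w≢v (cong (A' ,_) i≡k)

module _ {n : ℕ} {_<_ : Vertex n → Vertex n → Set}
         (sto : IsStrictTotalOrder _≡_ _<_) (cls : Vertex n → ℕ) where
  open IsStrictTotalOrder sto using (compare; irrefl; trans)

  consistent⇒cond1 : Consistent _<_ cls → Cond1 _<_ cls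
  consistent⇒cond1 consistent v v-little w same-cls same-side with compare v w
  ... | tri< v<w _ _ = inj₂ v<w
  ... | tri≈ _ v≡w _ = inj₁ v≡w
  ... | tri> _ _ w<v = ⊥-elim (¬edge-mirror v
          (consistent w v (mirror v) w<v v-little same-cls
            (edge-mirror same-side λ w≡v → irrefl w≡v w<v)))

  consistent⇒cond2 : Consistent _<_ cls → Cond2 _<_ cls
  consistent⇒cond2 consistent i j same-cls =
      (λ { (z , z≢i , vᵢ<v'ⱼ , v'ⱼ<v'_z) →
             consistent (A , i) (A' , j) (A' , z) vᵢ<v'ⱼ v'ⱼ<v'_z same-cls (λ i≡z → z≢i (sym i≡z)) })
    , (λ { (z , z≢j , v'ⱼ<vᵢ , vᵢ<v_z) →
             consistent (A' , j) (A , i) (A , z) v'ⱼ<vᵢ vᵢ<v_z (sym same-cls) (λ j≡z → z≢j (sym j≡z)) })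

  cond1⇒¬classmate<little : Cond1 _<_ cls → ∀ {p q} → little _<_ q →
    cls p ≡ cls q → side p ≡ side q → ¬ (p < q)
  cond1⇒¬classmate<little cond1 {p} {q} q-little same-cls same-side p<q
    with cond1 q q-little p same-cls same-side
  ... | inj₁ refl = irrefl refl p<q
  ... | inj₂ q<p  = irrefl refl (trans p<q q<p)

  cond1×cond2⇒consistent : Cond1 _<_ cls × Cond2 _<_ cls → Consistent _<_ cls
  cond1×cond2⇒consistent (cond1 , _) (A  , _) (A  , _) (A' , _) p<q q<r same-cls _ refl =
    cond1⇒¬classmate<little cond1 q<r same-cls refl p<q
  cond1×cond2⇒consistent (cond1 , _) (A' , _) (A' , _) (A  , _) p<q q<r same-cls _ refl =
    cond1⇒¬classmate<little cond1 q<r same-cls refl p<q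
  cond1×cond2⇒consistent (_ , cond2) (A  , i) (A' , j) (A' , z) p<q q<r same-cls i≢z =
    ⊥-elim (proj₁ (cond2 i j same-cls) (z , (λ z≡i → i≢z (sym z≡i)) , p<q , q<r))
  cond1×cond2⇒consistent (_ , cond2) (A' , j) (A  , i) (A  , z) p<q q<r same-cls j≢z =
    ⊥-elim (proj₂ (cond2 i j (sym same-cls)) (z , (λ z≡j → j≢z (sym z≡j)) , p<q , q<r))
  cond1×cond2⇒consistent _ (A  , _) _ (A  , _) _ _ _ ()
  cond1×cond2⇒consistent _ (A' , _) _ (A' , _) _ _ _ ()

theorem4 : (n : ℕ) → 1 ≤ n →
    (_<_ : Vertex n → Vertex n → Set) → IsStrictTotalOrder _≡_ _<_ →
    (cls : Vertex n → ℕ) →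
    Consistent _<_ cls ⇔ (Cond1 _<_ cls × Cond2 _<_ cls)
theorem4 n _ _<_ sto cls =
  mk⇔ (λ consistent → consistent⇒cond1 sto cls consistent , consistent⇒cond2 sto cls consistent)
      (cond1×cond2⇒consistent sto cls)
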